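{- With $P_{r+1}(\{a\})$ and $P$ as defined in the context, $$\det\big(P_{r+1}(\{a\})\big)=\det(P)=(-1)^{\frac{r(r+1)(r+2)}{2}}.$$
   Context: Let $r\ge1$. For $i\in[1,r]$ and nonzero $a,b,c$, $U_i(a,b,c)$ (resp. $V_i(a,b,c)$) is the $(r+1)\times(r+1)$ identity matrix except that its block in rows/columns $i,i+1$ is $\begin{pmatrix}1&0\\ c/b& a/b\end{pmatrix}$ (resp. $\begin{pmatrix}b/c& a/c\\ 0&1\end{pmatrix}$). $P$ is the $(r+1)\times(r+1)$ matrix with entries $P_{i,j}=(-1)^{(r-1)(i-1)}\delta_{i+j,r+2}$. With $a_1,\dots,a_r$ indeterminates, the array $(a_{i,-j})_{i,j\in[0,r+1]}$ is defined by $a_{i,0}=1$, $a_{0,-j}=a_{r+1,-j}=1$, $a_{i,-1}=a_i$ ($i\in[1,r]$), and $a_{i-1,-j}a_{i+1,-j}+a_{i,-j-1}a_{i,-j+1}=0$ for $i,j\in[1,r]$. For $i\in[1,r]$, $k\in[-r,0]$: $N_{i,k}(\{a\})=U_i(a_{i,k-1},a_{i,k},a_{i+1,k-1})$ if $i+k$ odd, $N_{i,k}(\{a\})=V_i(a_{i-1,k},a_{i,k-1},a_{i,k})$ if $i+k$ even. $P_{r+1}(\{a\})=\prod_{k=-r}^{0}\big(N_{1,k}(\{a\})\cdots N_{r,k}(\{a\})\big)$, factors ordered left to right by increasing $k$. -}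

module Defs where

open import Level using (_⊔_) renaming (suc to lsuc)
open import Algebra.Bundles using (CommutativeRing)
open import Data.Nat using (ℕ; zero; suc; _≟_; _≤ᵇ_)
import Data.Nat as ℕ
open import Data.Nat.DivMod using (_/_)
open import Data.Bool using (Bool; true; false; if_then_else_; _∧_; _∨_)
open import Data.Fin using (Fin; toℕ; punchIn) renaming (zero to fzero; suc to fsuc)
open import Data.List using (List; foldr; map; upTo; downFrom)
open import Relation.Nullary using (¬_)
open import Relation.Nullary.Decidable using (⌊_⌋)

-- A field: a commutative ring with 1 ≉ 0 and a (total) inverse function
-- which is a genuine inverse on nonzero elements (its value at 0 is irrelevant).
record Field (c ℓ : Level.Level) : Set (lsuc (c ⊔ ℓ)) where
  field
    commutativeRing : CommutativeRing c ℓ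
  open CommutativeRing commutativeRing public
  field
    _⁻¹      : Carrier → Carrier
    ⁻¹-cong  : ∀ {x y} → x ≈ y → (x ⁻¹) ≈ (y ⁻¹)
    inverse  : ∀ x → ¬ (x ≈ 0#) → (x * (x ⁻¹)) ≈ 1#
    1≉0      : ¬ (1# ≈ 0#)

module FieldDefs {c ℓ} (F : Field c ℓ) where
  open Field F

  infixl 7 _÷_
  _÷_ : Carrier → Carrier → Carrier
  x ÷ y = x * (y ⁻¹)

  neg1^ : ℕ → Carrier
  neg1^ zero    = 1#
  neg1^ (suc n) = - neg1^ n

  Mat : ℕ → Set c
  Mat n = Fin n → Fin n → Carrier

  sumFin : ∀ n → (Fin n → Carrier) → Carrier
  sumFin zero    f = 0#
  sumFin (suc n) f = f fzero + sumFin n (λ j → f (fsuc j))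

  infixl 7 _⊗_
  _⊗_ : ∀ {n} → Mat n → Mat n → Mat n
  (M ⊗ N) x y = sumFin _ (λ z → M x z * N z y)

  δ : ℕ → ℕ → Carrier
  δ x y = if ⌊ x ≟ y ⌋ then 1# else 0#

  idMat : ∀ {n} → Mat n
  idMat x y = δ (toℕ x) (toℕ y)

  prodList : ∀ {n} → List (Mat n) → Mat n
  prodList = foldr _⊗_ idMat

  det : ∀ n → Mat n → Carrier
  det zero    M = 1#
  det (suc n) M = sumFin (suc n) (λ j →
    (neg1^ (toℕ j) * M fzero j) * det n (λ x y → M (fsuc x) (punchIn j y)))

  -- Entries with 1-based indices (row x, column y).
  -- U_i(a,b,c): identity except block rows/cols i,i+1 = [[1,0],[c/b,a/b]]
  U : (r i : ℕ) → Carrier → Carrier → Carrier → Mat (suc r)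
  U r i a b c X Y =
    let x = suc (toℕ X) ; y = suc (toℕ Y) in
    if ⌊ x ≟ suc i ⌋ ∧ ⌊ y ≟ i ⌋ then c ÷ b
    else if ⌊ x ≟ suc i ⌋ ∧ ⌊ y ≟ suc i ⌋ then a ÷ b
    else δ x y

  -- V_i(a,b,c): identity except block rows/cols i,i+1 = [[b/c,a/c],[0,1]]
  V : (r i : ℕ) → Carrier → Carrier → Carrier → Mat (suc r)
  V r i a b c X Y =
    let x = suc (toℕ X) ; y = suc (toℕ Y) in
    if ⌊ x ≟ i ⌋ ∧ ⌊ y ≟ i ⌋ then b ÷ c
    else if ⌊ x ≟ i ⌋ ∧ ⌊ y ≟ suc i ⌋ then a ÷ c
    else δ x y

  -- P_{i,j} = (-1)^{(r-1)(i-1)} δ_{i+j,r+2}  (1-based i,j); here with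
  -- 0-based x = i-1, y = j-1 and r = suc r', so (r-1) = r'.
  Pmat : (r : ℕ) → Mat (suc r)
  Pmat r X Y =
    let x = toℕ X ; y = toℕ Y in
    if ⌊ x ℕ.+ y ≟ r ⌋ then neg1^ ((r ℕ.∸ 1) ℕ.* x) else 0#

  -- arr r a i j = a_{i,-j}  (a : ℕ → Carrier gives a_1..a_r at indices 1..r)
  --   a_{i,0} = 1, a_{0,-j} = a_{r+1,-j} = 1, a_{i,-1} = a_i,
  --   a_{i,-j-1} = - a_{i-1,-j} a_{i+1,-j} / a_{i,-j+1}
  boundary : ℕ → ℕ → Bool
  boundary r i = ⌊ i ≟ 0 ⌋ ∨ (suc r ≤ᵇ i)

  arr : (r : ℕ) → (ℕ → Carrier) → ℕ → ℕ → Carrier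
  arr r a i zero = 1#
  arr r a i (suc zero) = if boundary r i then 1# else a i
  arr r a i (suc (suc j)) =
    if boundary r i then 1#
    else (- (arr r a (i ℕ.∸ 1) (suc j) * arr r a (suc i) (suc j))) ÷ arr r a i j

  -- N_{i,k} with k = -m (m ∈ [0,r]); parity of i+k equals parity of i+m.
  odd : ℕ → Bool
  odd zero = false
  odd (suc n) with odd n
  ... | true = false
  ... | false = true

  N : (r : ℕ) → (ℕ → Carrier) → (i m : ℕ) → Mat (suc r)
  N r a i m =
    if odd (i ℕ.+ m)
    then U r i (arr r a i (suc m)) (arr r a i m) (arr r a (suc i) (suc m))
    else V r i (arr r a (i ℕ.∸ 1) m) (arr r a i (suc m)) (arr r a i m)

  -- P_{r+1}({a}) = ∏_{k=-r}^{0} (N_{1,k} ⋯ N_{r,k}), i.e. m = -k runs r, r-1, …, 0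
  Prod : (r : ℕ) → (ℕ → Carrier) → Mat (suc r)
  Prod r a = prodList (map (λ m → prodList (map (λ i → N r a (suc i) m) (upTo r)))
                           (downFrom (suc r)))

  signExp : ℕ → ℕ
  signExp r = (r ℕ.* (r ℕ.+ 1) ℕ.* (r ℕ.+ 2)) / 2

module Submission where

open import Defs
open import Data.Nat using (ℕ; suc; _≤_)
open import Data.Product using (_×_)
open import Relation.Nullary using (¬_)

open import Level using (_⊔_)
open import Data.Nat as ℕ using (zero; _<_; _∸_; z≤n; s≤s)
import Data.Nat.Properties as ℕP
open import Data.Nat.DivMod using (_/_; m*n/n≡m)
open import Data.Nat.Tactic.RingSolver using (solve-∀)
open import Data.Fin as Fin using (Fin; toℕ; punchIn; inject₁; fromℕ)
  renaming (zero to fzero; suc to fsuc)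
import Data.Fin.Properties as FinP
open import Data.List using (List; []; _∷_; _∷ʳ_; foldr; map; upTo; downFrom)
import Data.List.Properties as ListP
open import Data.List.Membership.Propositional using (_∈_)
open import Data.List.Membership.Propositional.Properties using (∈-upTo⁻)
open import Data.List.Relation.Unary.Any using (here; there)
open import Data.Bool using (true; false; if_then_else_)
open import Data.Bool.Properties using (T-≡)
open import Function.Bundles using (Equivalence)
open import Data.Product using (_,_; proj₁; proj₂)
open import Data.Sum using (inj₁; inj₂)
open import Function using (_∘_)
open import Relation.Binary.PropositionalEquality as ≡ using (_≡_; _≢_)
open import Relation.Nullary using (Dec; yes; no; contradiction)
open import Relation.Nullary.Decidable using (⌊_⌋)

-- Both determinants equal (-1)^{r·choose2(r+1)}, where choose2 n = n(n-1)/2.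
--
-- * det P: P is anti-diagonal, and the determinant of an anti-diagonal matrix
--   with entries g(0), …, g(r) is (-1)^{choose2(r+1)} g(0) ⋯ g(r).
-- * det P_{r+1}({a}): each factor U_i(a,b,c) (resp. V_i(a,b,c)) is an
--   elementary row operation between rows i and i+1, so left multiplication by
--   it scales every determinant by a/b (resp. b/c).  For N_{i,k} this factor is
--   a_{i,k-1}/a_{i,k}, and the product over k telescopes to a_{i,-(r+1)}.
-- * The array: the recurrence is a discrete wave equation, solved explicitly by
--   a d'Alembert-type product of a function of i + j and one of j - i (with a
--   sign).  Choosing these functions to match the boundary values, the
--   solution agrees with the array, and at depth r + 1 it equals (-1)^{r·i}.
--   Multiplying over i gives (-1)^{r·choose2(r+1)}.

-- choose2 n = 0 + 1 + ⋯ + (n - 1) = n(n-1)/2, the exponent of every sign below.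
module Choose2 where
  choose2 : ℕ → ℕ
  choose2 zero    = 0
  choose2 (suc n) = n ℕ.+ choose2 n

  choose2-double : ∀ n → choose2 (suc n) ℕ.* 2 ≡ n ℕ.* suc n
  choose2-double zero    = ≡.refl
  choose2-double (suc n) = begin
    (suc n ℕ.+ choose2 (suc n)) ℕ.* 2        ≡⟨ ℕP.*-distribʳ-+ 2 (suc n) (choose2 (suc n)) ⟩
    suc n ℕ.* 2 ℕ.+ choose2 (suc n) ℕ.* 2    ≡⟨ ≡.cong (suc n ℕ.* 2 ℕ.+_) (choose2-double n) ⟩
    suc n ℕ.* 2 ℕ.+ n ℕ.* suc n              ≡⟨ normalise n ⟩
    suc n ℕ.* suc (suc n)                    ∎
    where
    open ≡.≡-Reasoning
    normalise : ∀ n → suc n ℕ.* 2 ℕ.+ n ℕ.* suc n ≡ suc n ℕ.* suc (suc n)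
    normalise = solve-∀

  -- Pairs in a disjoint union: choose2 (m + n) = choose2 m + choose2 n + m n.
  choose2-+ : ∀ m n → choose2 (m ℕ.+ n) ≡ choose2 m ℕ.+ choose2 n ℕ.+ m ℕ.* n
  choose2-+ zero    n = ≡.sym (ℕP.+-identityʳ (choose2 n))
  choose2-+ (suc m) n = begin
    (m ℕ.+ n) ℕ.+ choose2 (m ℕ.+ n)                          ≡⟨ ≡.cong ((m ℕ.+ n) ℕ.+_) (choose2-+ m n) ⟩
    (m ℕ.+ n) ℕ.+ (choose2 m ℕ.+ choose2 n ℕ.+ m ℕ.* n)      ≡⟨ normalise m n (choose2 m) (choose2 n) ⟩
    (m ℕ.+ choose2 m) ℕ.+ choose2 n ℕ.+ suc m ℕ.* n          ∎
    where
    open ≡.≡-Reasoning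
    normalise : ∀ m n x y → (m ℕ.+ n) ℕ.+ (x ℕ.+ y ℕ.+ m ℕ.* n) ≡ (m ℕ.+ x) ℕ.+ y ℕ.+ suc m ℕ.* n
    normalise = solve-∀

  signExp-choose2 : ∀ r → r ℕ.* (r ℕ.+ 1) ℕ.* (r ℕ.+ 2) / 2 ≡ r ℕ.* choose2 (suc r) ℕ.+ choose2 (suc r) ℕ.* 2
  signExp-choose2 r = ≡.trans (≡.cong (_/ 2) product) (m*n/n≡m _ 2)
    where
    c : ℕ
    c = choose2 (suc r)
    open ≡.≡-Reasoning
    product : r ℕ.* (r ℕ.+ 1) ℕ.* (r ℕ.+ 2) ≡ (r ℕ.* c ℕ.+ c ℕ.* 2) ℕ.* 2
    product = begin
      r ℕ.* (r ℕ.+ 1) ℕ.* (r ℕ.+ 2)    ≡⟨ reassoc r ⟩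
      r ℕ.* suc r ℕ.* (r ℕ.+ 2)        ≡⟨ ≡.cong (ℕ._* (r ℕ.+ 2)) (choose2-double r) ⟨
      c ℕ.* 2 ℕ.* (r ℕ.+ 2)            ≡⟨ expand r c ⟩
      (r ℕ.* c ℕ.+ c ℕ.* 2) ℕ.* 2      ∎
      where
      reassoc : ∀ r → r ℕ.* (r ℕ.+ 1) ℕ.* (r ℕ.+ 2) ≡ r ℕ.* suc r ℕ.* (r ℕ.+ 2)
      reassoc = solve-∀
      expand : ∀ r c → c ℕ.* 2 ℕ.* (r ℕ.+ 2) ≡ (r ℕ.* c ℕ.+ c ℕ.* 2) ℕ.* 2
      expand = solve-∀

  -- For i = suc i' and i + k = r + 1, the sign exponents at the corner of the
  -- array combine to  i·r  modulo 2.
  choose2-corner : ∀ i' k → choose2 (suc i' ℕ.+ k) ℕ.+ choose2 (suc i') ℕ.+ choose2 k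
                           ≡ (i' ℕ.+ k) ℕ.* suc i' ℕ.+ choose2 k ℕ.* 2
  choose2-corner i' k = begin
    choose2 (i ℕ.+ k) ℕ.+ ci ℕ.+ ck                   ≡⟨ ≡.cong (λ t → t ℕ.+ ci ℕ.+ ck) (choose2-+ i k) ⟩
    (ci ℕ.+ ck ℕ.+ i ℕ.* k) ℕ.+ ci ℕ.+ ck             ≡⟨ regroup ci ck i k ⟩
    i ℕ.* k ℕ.+ ci ℕ.* 2 ℕ.+ ck ℕ.* 2                 ≡⟨ ≡.cong (λ t → i ℕ.* k ℕ.+ t ℕ.+ ck ℕ.* 2) (choose2-double i') ⟩
    i ℕ.* k ℕ.+ i' ℕ.* i ℕ.+ ck ℕ.* 2                 ≡⟨ collect i' k ck ⟩
    (i' ℕ.+ k) ℕ.* i ℕ.+ ck ℕ.* 2                     ∎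
    where
    i ci ck : ℕ
    i = suc i'
    ci = choose2 i
    ck = choose2 k
    open ≡.≡-Reasoning
    regroup : ∀ ci ck i k → (ci ℕ.+ ck ℕ.+ i ℕ.* k) ℕ.+ ci ℕ.+ ck ≡ i ℕ.* k ℕ.+ ci ℕ.* 2 ℕ.+ ck ℕ.* 2
    regroup = solve-∀
    collect : ∀ i' k ck → suc i' ℕ.* k ℕ.+ i' ℕ.* suc i' ℕ.+ ck ℕ.* 2 ≡ (i' ℕ.+ k) ℕ.* suc i' ℕ.+ ck ℕ.* 2
    collect = solve-∀

open Choose2

module FieldFacts {c ℓ} (F : Field c ℓ) where
  open Field F
  open FieldDefs F
  open import Relation.Binary.Reasoning.Setoid setoid
  open import Algebra.Properties.Ring ring using (-‿involutive; -‿distribˡ-*; -‿distribʳ-*)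

  ÷-cancelʳ : ∀ x {w} → ¬ (w ≈ 0#) → (x ÷ w) * w ≈ x
  ÷-cancelʳ x {w} w≉0 = begin
    (x * w ⁻¹) * w  ≈⟨ *-assoc x (w ⁻¹) w ⟩
    x * (w ⁻¹ * w)  ≈⟨ *-congˡ (trans (*-comm (w ⁻¹) w) (inverse w w≉0)) ⟩
    x * 1#          ≈⟨ *-identityʳ x ⟩
    x               ∎

  ÷-unique : ∀ {x y w} → ¬ (w ≈ 0#) → x * w ≈ y → x ≈ y ÷ w
  ÷-unique {x} {y} {w} w≉0 xw≈y = begin
    x                ≈⟨ *-identityʳ x ⟨
    x * 1#           ≈⟨ *-congˡ (inverse w w≉0) ⟨
    x * (w * w ⁻¹)   ≈⟨ *-assoc x w (w ⁻¹) ⟨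
    (x * w) * w ⁻¹   ≈⟨ *-congʳ xw≈y ⟩
    y ÷ w            ∎

  *-nonzero : ∀ {x y} → ¬ (x ≈ 0#) → ¬ (y ≈ 0#) → ¬ (x * y ≈ 0#)
  *-nonzero {x} {y} x≉0 y≉0 xy≈0 = y≉0 (begin
    y                 ≈⟨ *-identityˡ y ⟨
    1# * y            ≈⟨ *-congʳ (trans (*-comm (x ⁻¹) x) (inverse x x≉0)) ⟨
    (x ⁻¹ * x) * y    ≈⟨ *-assoc (x ⁻¹) x y ⟩
    x ⁻¹ * (x * y)    ≈⟨ *-congˡ xy≈0 ⟩
    x ⁻¹ * 0#         ≈⟨ zeroʳ (x ⁻¹) ⟩
    0#                ∎)

  neg-*-neg : ∀ x y → (- x) * (- y) ≈ x * y
  neg-*-neg x y = begin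
    (- x) * (- y)   ≈⟨ -‿distribˡ-* x (- y) ⟨
    - (x * - y)     ≈⟨ -‿cong (-‿distribʳ-* x y) ⟨
    - - (x * y)     ≈⟨ -‿involutive (x * y) ⟩
    x * y           ∎

  neg1^-+ : ∀ m n → neg1^ (m ℕ.+ n) ≈ neg1^ m * neg1^ n
  neg1^-+ zero    n = sym (*-identityˡ (neg1^ n))
  neg1^-+ (suc m) n = trans (-‿cong (neg1^-+ m n)) (-‿distribˡ-* (neg1^ m) (neg1^ n))

  neg1^-even : ∀ k → neg1^ (k ℕ.* 2) ≈ 1#
  neg1^-even zero    = refl
  neg1^-even (suc k) = trans (-‿involutive (neg1^ (k ℕ.* 2))) (neg1^-even k)

  neg1^-+even : ∀ m k → neg1^ (m ℕ.+ k ℕ.* 2) ≈ neg1^ m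
  neg1^-+even m k = begin
    neg1^ (m ℕ.+ k ℕ.* 2)         ≈⟨ neg1^-+ m (k ℕ.* 2) ⟩
    neg1^ m * neg1^ (k ℕ.* 2)     ≈⟨ *-congˡ (neg1^-even k) ⟩
    neg1^ m * 1#                  ≈⟨ *-identityʳ (neg1^ m) ⟩
    neg1^ m                       ∎

  neg1^-square : ∀ n → neg1^ n * neg1^ n ≈ 1#
  neg1^-square zero    = *-identityˡ 1#
  neg1^-square (suc n) = trans (neg-*-neg (neg1^ n) (neg1^ n)) (neg1^-square n)

module Products {c ℓ} (F : Field c ℓ) where
  open Field F
  open FieldDefs F
  open FieldFacts F
  open import Relation.Binary.Reasoning.Setoid setoid
  open import Algebra.Solver.Ring.NaturalCoefficients.Default commutativeSemiring

  ∏ : List ℕ → (ℕ → Carrier) → Carrier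
  ∏ is w = foldr (λ i p → w i * p) 1# is

  ∏-cong : ∀ is {w v : ℕ → Carrier} → (∀ i → i ∈ is → w i ≈ v i) → ∏ is w ≈ ∏ is v
  ∏-cong []       w≈v = refl
  ∏-cong (i ∷ is) w≈v = *-cong (w≈v i (here ≡.refl)) (∏-cong is (λ j j∈is → w≈v j (there j∈is)))

  ∏-map : ∀ (f : ℕ → ℕ) is w → ∏ (map f is) w ≡ ∏ is (w ∘ f)
  ∏-map f is w = ListP.foldr-map (λ i p → w i * p) f 1# is

  ∏-∷ʳ : ∀ is i w → ∏ (is ∷ʳ i) w ≈ ∏ is w * w i
  ∏-∷ʳ []       i w = trans (*-identityʳ (w i)) (sym (*-identityˡ (w i)))
  ∏-∷ʳ (j ∷ is) i w = trans (*-congˡ (∏-∷ʳ is i w)) (sym (*-assoc (w j) _ (w i)))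

  ∏-upTo-suc : ∀ n w → ∏ (upTo (suc n)) w ≡ w 0 * ∏ (upTo n) (w ∘ suc)
  ∏-upTo-suc n w = ≡.cong (w 0 *_)
    (≡.trans (≡.cong (λ is → ∏ is w) (≡.sym (ListP.map-upTo suc n))) (∏-map suc (upTo n) w))

  ∏-1 : ∀ is → ∏ is (λ _ → 1#) ≈ 1#
  ∏-1 []       = refl
  ∏-1 (i ∷ is) = trans (*-identityˡ _) (∏-1 is)

  ∏-* : ∀ is w v → ∏ is (λ i → w i * v i) ≈ ∏ is w * ∏ is v
  ∏-* []       w v = sym (*-identityˡ 1#)
  ∏-* (i ∷ is) w v = trans (*-congˡ (∏-* is w v))
    (solve 4 (λ a b x y → (a :* b) :* (x :* y) := (a :* x) :* (b :* y)) refl (w i) (v i) (∏ is w) (∏ is v))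

  ∏-comm : ∀ ms is (q : ℕ → ℕ → Carrier) →
           ∏ ms (λ m → ∏ is (q m)) ≈ ∏ is (λ i → ∏ ms (λ m → q m i))
  ∏-comm []       is q = sym (∏-1 is)
  ∏-comm (m ∷ ms) is q = trans (*-congˡ (∏-comm ms is q)) (sym (∏-* is (q m) (λ i → ∏ ms (λ m' → q m' i))))

  ∏-telescope : ∀ (A : ℕ → Carrier) k → (∀ m → m < k → ¬ (A m ≈ 0#)) →
                ∏ (downFrom k) (λ m → A (suc m) ÷ A m) * A 0 ≈ A k
  ∏-telescope A zero    A≉0 = *-identityˡ (A 0)
  ∏-telescope A (suc k) A≉0 = begin
    (A (suc k) ÷ A k * P) * A 0  ≈⟨ *-assoc (A (suc k) ÷ A k) P (A 0) ⟩
    A (suc k) ÷ A k * (P * A 0)  ≈⟨ *-congˡ (∏-telescope A k (λ m m<k → A≉0 m (ℕP.m<n⇒m<1+n m<k))) ⟩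
    A (suc k) ÷ A k * A k        ≈⟨ ÷-cancelʳ (A (suc k)) (A≉0 k (ℕP.n<1+n k)) ⟩
    A (suc k)                    ∎
    where
    P : Carrier
    P = ∏ (downFrom k) (λ m → A (suc m) ÷ A m)

  ∏-neg1^-linear : ∀ d n → ∏ (upTo n) (λ x → neg1^ (d ℕ.* x)) ≈ neg1^ (d ℕ.* choose2 n)
  ∏-neg1^-linear d zero    = reflexive (≡.cong neg1^ (≡.sym (ℕP.*-zeroʳ d)))
  ∏-neg1^-linear d (suc n) = begin
    ∏ (upTo (suc n)) s                         ≡⟨ ≡.cong (λ is → ∏ is s) (ListP.upTo-∷ʳ n) ⟨
    ∏ (upTo n ∷ʳ n) s                          ≈⟨ ∏-∷ʳ (upTo n) n s ⟩
    ∏ (upTo n) s * neg1^ (d ℕ.* n)             ≈⟨ *-congʳ (∏-neg1^-linear d n) ⟩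
    neg1^ (d ℕ.* choose2 n) * neg1^ (d ℕ.* n)  ≈⟨ neg1^-+ (d ℕ.* choose2 n) (d ℕ.* n) ⟨
    neg1^ (d ℕ.* choose2 n ℕ.+ d ℕ.* n)        ≡⟨ ≡.cong neg1^ (ℕP.+-comm (d ℕ.* choose2 n) (d ℕ.* n)) ⟩
    neg1^ (d ℕ.* n ℕ.+ d ℕ.* choose2 n)        ≡⟨ ≡.cong neg1^ (ℕP.*-distribˡ-+ d n (choose2 n)) ⟨
    neg1^ (d ℕ.* choose2 (suc n))              ∎
    where
    s : ℕ → Carrier
    s x = neg1^ (d ℕ.* x)

module Decisions where
  ⌊⌋-yes : ∀ {p} {P : Set p} (d : Dec P) → P → ⌊ d ⌋ ≡ true
  ⌊⌋-yes (yes _)  _ = ≡.refl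
  ⌊⌋-yes (no ¬P) P = contradiction P ¬P

  ⌊⌋-no : ∀ {p} {P : Set p} (d : Dec P) → ¬ P → ⌊ d ⌋ ≡ false
  ⌊⌋-no (yes P) ¬P = contradiction P ¬P
  ⌊⌋-no (no _)  _  = ≡.refl

  ⌊suc≟suc⌋ : ∀ m n → ⌊ suc m ℕ.≟ suc n ⌋ ≡ ⌊ m ℕ.≟ n ⌋
  ⌊suc≟suc⌋ m n with m ℕ.≟ n
  ... | yes m≡n = ⌊⌋-yes (suc m ℕ.≟ suc n) (≡.cong suc m≡n)
  ... | no m≢n  = ⌊⌋-no (suc m ℕ.≟ suc n) (m≢n ∘ ℕP.suc-injective)

open Decisions

module Matrices {c ℓ} (F : Field c ℓ) where
  open Field F
  open FieldDefs F
  open FieldFacts F using (neg-*-neg)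
  open import Algebra.Properties.Ring ring using (-‿involutive; -‿distribˡ-*)
  open import Relation.Binary.Reasoning.Setoid setoid
  open import Algebra.Solver.Ring.NaturalCoefficients.Default commutativeSemiring

  sumFin-cong : ∀ n {f g : Fin n → Carrier} → (∀ j → f j ≈ g j) → sumFin n f ≈ sumFin n g
  sumFin-cong zero    f≈g = refl
  sumFin-cong (suc n) f≈g = +-cong (f≈g fzero) (sumFin-cong n (f≈g ∘ fsuc))

  sumFin-zero : ∀ n {f : Fin n → Carrier} → (∀ j → f j ≈ 0#) → sumFin n f ≈ 0#
  sumFin-zero zero    f≈0 = refl
  sumFin-zero (suc n) f≈0 = trans (+-cong (f≈0 fzero) (sumFin-zero n (f≈0 ∘ fsuc))) (+-identityˡ 0#)

  sumFin-+ : ∀ n (f g : Fin n → Carrier) → sumFin n (λ j → f j + g j) ≈ sumFin n f + sumFin n g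
  sumFin-+ zero    f g = sym (+-identityˡ 0#)
  sumFin-+ (suc n) f g = trans (+-congˡ (sumFin-+ n (f ∘ fsuc) (g ∘ fsuc)))
    (solve 4 (λ a b x y → (a :+ b) :+ (x :+ y) := (a :+ x) :+ (b :+ y)) refl
       (f fzero) (g fzero) (sumFin n (f ∘ fsuc)) (sumFin n (g ∘ fsuc)))

  sumFin-*ˡ : ∀ n a (f : Fin n → Carrier) → sumFin n (λ j → a * f j) ≈ a * sumFin n f
  sumFin-*ˡ zero    a f = sym (zeroʳ a)
  sumFin-*ˡ (suc n) a f = trans (+-congˡ (sumFin-*ˡ n a (f ∘ fsuc))) (sym (distribˡ a _ _))

  sumFin-*ʳ : ∀ n a (f : Fin n → Carrier) → sumFin n (λ j → f j * a) ≈ sumFin n f * a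
  sumFin-*ʳ n a f = trans (sumFin-cong n (λ j → *-comm (f j) a)) (trans (sumFin-*ˡ n a f) (*-comm a _))

  sumFin-linear : ∀ n (α β : Carrier) (t u v : Fin n → Carrier) → (∀ j → t j ≈ α * u j + β * v j) →
                  sumFin n t ≈ α * sumFin n u + β * sumFin n v
  sumFin-linear n α β t u v t≈ =
    trans (sumFin-cong n t≈) (trans (sumFin-+ n _ _) (+-cong (sumFin-*ˡ n α u) (sumFin-*ˡ n β v)))

  sumFin-single : ∀ n (k : Fin n) (f : Fin n → Carrier) → (∀ j → j ≢ k → f j ≈ 0#) → sumFin n f ≈ f k
  sumFin-single (suc n) fzero    f f≈0 =
    trans (+-congˡ (sumFin-zero n (λ j → f≈0 (fsuc j) (λ ())))) (+-identityʳ (f fzero))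
  sumFin-single (suc n) (fsuc k) f f≈0 =
    trans (+-congʳ (f≈0 fzero (λ ())))
          (trans (+-identityˡ _) (sumFin-single n k (f ∘ fsuc) (λ j j≢k → f≈0 (fsuc j) (j≢k ∘ FinP.suc-injective))))

  sumFin-comm : ∀ n m (f : Fin n → Fin m → Carrier) →
                sumFin n (λ i → sumFin m (f i)) ≈ sumFin m (λ j → sumFin n (λ i → f i j))
  sumFin-comm zero    m f = sym (sumFin-zero m (λ _ → refl))
  sumFin-comm (suc n) m f = trans (+-congˡ (sumFin-comm n m (f ∘ fsuc)))
                                  (sym (sumFin-+ m (f fzero) (λ j → sumFin n (λ i → f (fsuc i) j))))

  δ-diag : ∀ m → δ m m ≈ 1#
  δ-diag m rewrite ⌊⌋-yes (m ℕ.≟ m) ≡.refl = refl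

  δ-offdiag : ∀ {m n} → m ≢ n → δ m n ≈ 0#
  δ-offdiag {m} {n} m≢n rewrite ⌊⌋-no (m ℕ.≟ n) m≢n = refl

  δ-suc : ∀ m n → δ (suc m) (suc n) ≈ δ m n
  δ-suc m n = by-cases (m ℕ.≟ n)
    where
    by-cases : Dec (m ≡ n) → δ (suc m) (suc n) ≈ δ m n
    by-cases (yes ≡.refl) = trans (δ-diag (suc m)) (sym (δ-diag m))
    by-cases (no m≢n)     = trans (δ-offdiag (m≢n ∘ ℕP.suc-injective)) (sym (δ-offdiag m≢n))

  idMat-offdiag : ∀ {n} {x z : Fin n} → x ≢ z → idMat x z ≈ 0#
  idMat-offdiag x≢z = δ-offdiag (x≢z ∘ FinP.toℕ-injective)

  infix 4 _≋_
  _≋_ : ∀ {n} → Mat n → Mat n → Set ℓ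
  M ≋ N = ∀ x y → M x y ≈ N x y

  ⊗-identityˡ : ∀ {n} (M : Mat n) → idMat ⊗ M ≋ M
  ⊗-identityˡ {n} M x y =
    trans (sumFin-single n x _ (λ z z≢x → trans (*-congʳ (idMat-offdiag (z≢x ∘ ≡.sym))) (zeroˡ _)))
          (trans (*-congʳ (δ-diag (toℕ x))) (*-identityˡ (M x y)))

  ⊗-identityʳ : ∀ {n} (M : Mat n) → M ⊗ idMat ≋ M
  ⊗-identityʳ {n} M x y =
    trans (sumFin-single n y _ (λ z z≢y → trans (*-congˡ (idMat-offdiag z≢y)) (zeroʳ _)))
          (trans (*-congˡ (δ-diag (toℕ y))) (*-identityʳ (M x y)))

  ⊗-assoc : ∀ {n} (A B C : Mat n) → (A ⊗ B) ⊗ C ≋ A ⊗ (B ⊗ C)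
  ⊗-assoc {n} A B C x y = begin
    sumFin n (λ z → sumFin n (λ w → A x w * B w z) * C z y)
      ≈⟨ sumFin-cong n (λ z → sumFin-*ʳ n (C z y) _) ⟨
    sumFin n (λ z → sumFin n (λ w → A x w * B w z * C z y))
      ≈⟨ sumFin-comm n n _ ⟩
    sumFin n (λ w → sumFin n (λ z → A x w * B w z * C z y))
      ≈⟨ sumFin-cong n (λ w → trans (sumFin-cong n (λ z → *-assoc _ _ _)) (sumFin-*ˡ n (A x w) _)) ⟩
    sumFin n (λ w → A x w * sumFin n (λ z → B w z * C z y)) ∎

  minor : ∀ {n} → Mat (suc n) → Fin (suc n) → Mat n
  minor M j x y = M (fsuc x) (punchIn j y)

  det-cong : ∀ n {M N : Mat n} → M ≋ N → det n M ≈ det n N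
  det-cong zero    M≋N = refl
  det-cong (suc n) M≋N = sumFin-cong (suc n) (λ j →
    *-cong (*-congˡ {neg1^ (toℕ j)} (M≋N fzero j)) (det-cong n (λ x y → M≋N (fsuc x) (punchIn j y))))

  det-idMat : ∀ n → det n idMat ≈ 1#
  det-idMat zero    = refl
  det-idMat (suc n) = begin
    det (suc n) idMat
      ≈⟨ sumFin-single (suc n) fzero _ (λ j j≢0 →
           trans (*-congʳ (trans (*-congˡ {neg1^ (toℕ j)} (idMat-offdiag (j≢0 ∘ ≡.sym))) (zeroʳ _)))
                 (zeroˡ (det n (minor idMat j)))) ⟩
    (1# * δ 0 0) * det n (minor idMat fzero)
      ≈⟨ *-cong (trans (*-identityˡ _) (δ-diag 0))
                (trans (det-cong n (λ x y → δ-suc (toℕ x) (toℕ y))) (det-idMat n)) ⟩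
    1# * 1#
      ≈⟨ *-identityˡ 1# ⟩
    1# ∎

  -- Each Laplace term along the first row is linear: directly if p is the
  -- first row, and through the minor (by induction) otherwise.
  det-linear : ∀ n (p : Fin (suc n)) (α β : Carrier) (A B C : Mat (suc n)) →
    (∀ x y → x ≢ p → A x y ≈ B x y) → (∀ x y → x ≢ p → A x y ≈ C x y) →
    (∀ y → A p y ≈ α * B p y + β * C p y) → det (suc n) A ≈ α * det (suc n) B + β * det (suc n) C
  det-linear n fzero α β A B C A≈B A≈C row₀ = sumFin-linear (suc n) α β _ _ _ λ j → begin
    (s j * A fzero j) * det n (minor A j)
      ≈⟨ *-congʳ (*-congˡ (row₀ j)) ⟩
    (s j * (α * B fzero j + β * C fzero j)) * det n (minor A j)
      ≈⟨ solve 6 (λ σ a b x y d → (σ :* (a :* x :+ b :* y)) :* d := a :* ((σ :* x) :* d) :+ b :* ((σ :* y) :* d))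
           refl (s j) α β (B fzero j) (C fzero j) (det n (minor A j)) ⟩
    α * ((s j * B fzero j) * det n (minor A j)) + β * ((s j * C fzero j) * det n (minor A j))
      ≈⟨ +-cong (*-congˡ (*-congˡ (det-cong n (λ x y → A≈B (fsuc x) (punchIn j y) (λ ())))))
                (*-congˡ (*-congˡ (det-cong n (λ x y → A≈C (fsuc x) (punchIn j y) (λ ()))))) ⟩
    α * ((s j * B fzero j) * det n (minor B j)) + β * ((s j * C fzero j) * det n (minor C j)) ∎
    where
    s : Fin (suc n) → Carrier
    s j = neg1^ (toℕ j)
  det-linear (suc n) (fsuc p) α β A B C A≈B A≈C rowₚ = sumFin-linear (suc (suc n)) α β _ _ _ λ j → begin
    (s j * A fzero j) * det (suc n) (minor A j)
      ≈⟨ *-congˡ (det-linear n p α β (minor A j) (minor B j) (minor C j)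
            (λ x y x≢p → A≈B (fsuc x) (punchIn j y) (x≢p ∘ FinP.suc-injective))
            (λ x y x≢p → A≈C (fsuc x) (punchIn j y) (x≢p ∘ FinP.suc-injective))
            (λ y → rowₚ (punchIn j y))) ⟩
    (s j * A fzero j) * (α * det (suc n) (minor B j) + β * det (suc n) (minor C j))
      ≈⟨ solve 5 (λ t a b x y → t :* (a :* x :+ b :* y) := a :* (t :* x) :+ b :* (t :* y))
           refl (s j * A fzero j) α β (det (suc n) (minor B j)) (det (suc n) (minor C j)) ⟩
    α * ((s j * A fzero j) * det (suc n) (minor B j)) + β * ((s j * A fzero j) * det (suc n) (minor C j))
      ≈⟨ +-cong (*-congˡ (*-congʳ (*-congˡ (A≈B fzero j (λ ())))))
                (*-congˡ (*-congʳ (*-congˡ (A≈C fzero j (λ ()))))) ⟩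
    α * ((s j * B fzero j) * det (suc n) (minor B j)) + β * ((s j * C fzero j) * det (suc n) (minor C j)) ∎
    where
    s : Fin (suc (suc n)) → Carrier
    s j = neg1^ (toℕ j)

  -- Deleting column j and then column l of the remaining ones deletes the same
  -- two columns as deleting j' = punchIn j l first and then l', the position of j
  -- among the remaining ones.  The two orders of deletion have opposite signs.
  punchIn-exchange : ∀ {n} (j : Fin (suc (suc n))) (l l' : Fin (suc n)) → punchIn (punchIn j l) l' ≡ j →
                     ∀ y → punchIn j (punchIn l y) ≡ punchIn (punchIn j l) (punchIn l' y)
  punchIn-exchange fzero    l        fzero     _ y = ≡.refl
  punchIn-exchange (fsuc j) fzero    l'        ≡.refl y = ≡.refl
  punchIn-exchange {suc n} (fsuc j) (fsuc l) (fsuc l') e fzero    = ≡.refl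
  punchIn-exchange {suc n} (fsuc j) (fsuc l) (fsuc l') e (fsuc y) =
    ≡.cong fsuc (punchIn-exchange j l l' (FinP.suc-injective e) y)

  punchIn-exchange-sign : ∀ {n} (j : Fin (suc (suc n))) (l l' : Fin (suc n)) → punchIn (punchIn j l) l' ≡ j →
    neg1^ (toℕ j) * neg1^ (toℕ l) ≈ - (neg1^ (toℕ (punchIn j l)) * neg1^ (toℕ l'))
  punchIn-exchange-sign fzero    l        fzero     _ =
    trans (*-identityˡ _) (trans (sym (-‿involutive _)) (-‿cong (sym (*-identityʳ _))))
  punchIn-exchange-sign (fsuc j) fzero    l'        ≡.refl = trans (*-identityʳ _) (-‿cong (sym (*-identityˡ _)))
  punchIn-exchange-sign {suc n} (fsuc j) (fsuc l) (fsuc l') e =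
    trans (neg-*-neg _ _) (trans (punchIn-exchange-sign j l l' (FinP.suc-injective e)) (-‿cong (sym (neg-*-neg _ _))))

  sumFin-exchange-zero : ∀ n (f : Fin (suc n) → Fin n → Carrier) →
    (∀ j l l' → punchIn (punchIn j l) l' ≡ j → f j l ≈ - f (punchIn j l) l') →
    sumFin (suc n) (λ j → sumFin n (f j)) ≈ 0#
  sumFin-exchange-zero zero    f anti = +-identityˡ 0#
  sumFin-exchange-zero (suc n) f anti = begin
    sumFin (suc n) (f fzero) + sumFin (suc n) (λ j → f (fsuc j) fzero + sumFin n (f (fsuc j) ∘ fsuc))
      ≈⟨ +-congˡ (sumFin-+ (suc n) (λ j → f (fsuc j) fzero) (λ j → sumFin n (f (fsuc j) ∘ fsuc))) ⟩
    sumFin (suc n) (f fzero) + (sumFin (suc n) (λ j → f (fsuc j) fzero) + sumFin (suc n) (λ j → sumFin n (f (fsuc j) ∘ fsuc)))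
      ≈⟨ +-assoc _ _ _ ⟨
    (sumFin (suc n) (f fzero) + sumFin (suc n) (λ j → f (fsuc j) fzero)) + sumFin (suc n) (λ j → sumFin n (f (fsuc j) ∘ fsuc))
      ≈⟨ +-cong first-pairs (sumFin-exchange-zero n (λ j l → f (fsuc j) (fsuc l))
                               (λ j l l' e → anti (fsuc j) (fsuc l) (fsuc l') (≡.cong fsuc e))) ⟩
    0# + 0#
      ≈⟨ +-identityˡ 0# ⟩
    0# ∎
    where
    -- the terms (0, l) and (l + 1, 0) cancel
    first-pairs : sumFin (suc n) (f fzero) + sumFin (suc n) (λ j → f (fsuc j) fzero) ≈ 0#
    first-pairs = trans (sym (sumFin-+ (suc n) (f fzero) (λ j → f (fsuc j) fzero)))
      (sumFin-zero (suc n) (λ l → trans (+-congʳ (anti fzero l fzero ≡.refl)) (-‿inverseˡ _)))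

  -- A matrix with equal first two rows has determinant zero: expand along
  -- both rows and cancel the terms in pairs.
  det-equal-first-rows : ∀ n (M : Mat (suc (suc n))) → (∀ y → M fzero y ≈ M (fsuc fzero) y) →
                         det (suc (suc n)) M ≈ 0#
  det-equal-first-rows n M rows≈ = trans
    (sumFin-cong (suc (suc n)) (λ j → sym (sumFin-*ˡ (suc n) (s j * M fzero j) (λ l → (s l * M (fsuc fzero) (punchIn j l)) * D j l))))
    (sumFin-exchange-zero (suc n) f anti)
    where
    s : ∀ {m} → Fin m → Carrier
    s j = neg1^ (toℕ j)
    D : Fin (suc (suc n)) → Fin (suc n) → Carrier
    D j l = det n (λ x y → M (fsuc (fsuc x)) (punchIn j (punchIn l y)))
    f : Fin (suc (suc n)) → Fin (suc n) → Carrier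
    f j l = (s j * M fzero j) * ((s l * M (fsuc fzero) (punchIn j l)) * D j l)
    anti : ∀ j l l' → punchIn (punchIn j l) l' ≡ j → f j l ≈ - f (punchIn j l) l'
    anti j l l' e = begin
      (s j * M fzero j) * ((s l * M (fsuc fzero) j') * D j l)
        ≈⟨ *-cong (*-congˡ (rows≈ j)) (*-congʳ (*-congˡ (sym (rows≈ j')))) ⟩
      (s j * M (fsuc fzero) j) * ((s l * M fzero j') * D j l)
        ≈⟨ solve 5 (λ a b x y d → (a :* x) :* ((b :* y) :* d) := (a :* b) :* ((y :* x) :* d))
             refl (s j) (s l) (M (fsuc fzero) j) (M fzero j') (D j l) ⟩
      (s j * s l) * ((M fzero j' * M (fsuc fzero) j) * D j l)
        ≈⟨ *-cong (punchIn-exchange-sign j l l' e)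
                  (*-congˡ (det-cong n (λ x y → reflexive (≡.cong (M (fsuc (fsuc x))) (punchIn-exchange j l l' e y))))) ⟩
      - (s j' * s l') * ((M fzero j' * M (fsuc fzero) j) * D j' l')
        ≈⟨ -‿distribˡ-* _ _ ⟨
      - ((s j' * s l') * ((M fzero j' * M (fsuc fzero) j) * D j' l'))
        ≈⟨ -‿cong (solve 5 (λ a b x y d → (a :* b) :* ((x :* y) :* d) := (a :* x) :* ((b :* y) :* d))
                     refl (s j') (s l') (M fzero j') (M (fsuc fzero) j) (D j' l')) ⟩
      - ((s j' * M fzero j') * ((s l' * M (fsuc fzero) j) * D j' l'))
        ≡⟨ ≡.cong (λ k → - ((s j' * M fzero j') * ((s l' * M (fsuc fzero) k) * D j' l'))) (≡.sym e) ⟩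
      - ((s j' * M fzero j') * ((s l' * M (fsuc fzero) (punchIn j' l')) * D j' l')) ∎
      where
      j' : Fin (suc (suc n))
      j' = punchIn j l

  det-equal-adjacent-rows : ∀ n (k : Fin n) (M : Mat (suc n)) → (∀ y → M (inject₁ k) y ≈ M (fsuc k) y) →
                            det (suc n) M ≈ 0#
  det-equal-adjacent-rows (suc n) fzero    M rows≈ = det-equal-first-rows n M rows≈
  det-equal-adjacent-rows (suc n) (fsuc k) M rows≈ = sumFin-zero (suc (suc n)) (λ j →
    trans (*-congˡ {neg1^ (toℕ j) * M fzero j} (det-equal-adjacent-rows n k (minor M j) (rows≈ ∘ punchIn j))) (zeroʳ _))

module RowOperations {c ℓ} (F : Field c ℓ) where
  open Field F
  open FieldDefs F
  open Matrices F
  open Products F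
  open import Relation.Binary.Reasoning.Setoid setoid

  replaceRow : ∀ {n} → Mat n → Fin n → (Fin n → Carrier) → Mat n
  replaceRow M p v x y = if ⌊ x Fin.≟ p ⌋ then v y else M x y

  replaceRow-here : ∀ {n} (M : Mat n) p v y → replaceRow M p v p y ≈ v y
  replaceRow-here M p v y rewrite ⌊⌋-yes (p Fin.≟ p) ≡.refl = refl

  replaceRow-there : ∀ {n} (M : Mat n) p v {x} y → x ≢ p → replaceRow M p v x y ≈ M x y
  replaceRow-there M p v {x} y x≢p rewrite ⌊⌋-no (x Fin.≟ p) x≢p = refl

  data Adjacent {n} : Fin (suc n) → Fin (suc n) → Set where
    below : ∀ k → Adjacent (fsuc k) (inject₁ k)
    above : ∀ k → Adjacent (inject₁ k) (fsuc k)

  inject₁≢fsuc : ∀ {n} (k : Fin n) → inject₁ k ≢ fsuc k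
  inject₁≢fsuc k e = ℕP.1+n≢n (≡.sym (≡.trans (≡.sym (FinP.toℕ-inject₁ k)) (≡.cong toℕ e)))

  -- Copying a row onto a neighbouring row creates two equal adjacent rows.
  det-copyRow : ∀ {n} {p q : Fin (suc n)} (M : Mat (suc n)) → Adjacent p q →
                det (suc n) (replaceRow M p (M q)) ≈ 0#
  det-copyRow {n} M (below k) = det-equal-adjacent-rows n k (replaceRow M (fsuc k) (M (inject₁ k))) (λ y →
    trans (replaceRow-there M (fsuc k) (M (inject₁ k)) y (inject₁≢fsuc k))
          (sym (replaceRow-here M (fsuc k) (M (inject₁ k)) y)))
  det-copyRow {n} M (above k) = det-equal-adjacent-rows n k (replaceRow M (inject₁ k) (M (fsuc k))) (λ y →
    trans (replaceRow-here M (inject₁ k) (M (fsuc k)) y)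
          (sym (replaceRow-there M (inject₁ k) (M (fsuc k)) y (inject₁≢fsuc k ∘ ≡.sym))))

  det-rowop : ∀ {n} {p q : Fin (suc n)} (α β : Carrier) (A M : Mat (suc n)) → Adjacent p q →
    (∀ x y → x ≢ p → A x y ≈ M x y) → (∀ y → A p y ≈ β * M p y + α * M q y) →
    det (suc n) A ≈ β * det (suc n) M
  det-rowop {n} {p} {q} α β A M adj A≈M rowₚ = begin
    det (suc n) A
      ≈⟨ det-linear n p β α A M C A≈M (λ x y x≢p → trans (A≈M x y x≢p) (sym (replaceRow-there M p (M q) y x≢p)))
                    (λ y → trans (rowₚ y) (+-congˡ (*-congˡ (sym (replaceRow-here M p (M q) y))))) ⟩
    β * det (suc n) M + α * det (suc n) C
      ≈⟨ +-congˡ (trans (*-congˡ (det-copyRow M adj)) (zeroʳ α)) ⟩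
    β * det (suc n) M + 0#
      ≈⟨ +-identityʳ _ ⟩
    β * det (suc n) M ∎
    where
    C : Mat (suc n)
    C = replaceRow M p (M q)

  ScalesDet : ∀ n → Mat n → Carrier → Set (c ⊔ ℓ)
  ScalesDet n X e = ∀ M → det n (X ⊗ M) ≈ e * det n M

  ScalesDet-det : ∀ n {X e} → ScalesDet n X e → det n X ≈ e
  ScalesDet-det n {X} {e} scales = begin
    det n X              ≈⟨ det-cong n (⊗-identityʳ X) ⟨
    det n (X ⊗ idMat)    ≈⟨ scales idMat ⟩
    e * det n idMat      ≈⟨ *-congˡ (det-idMat n) ⟩
    e * 1#               ≈⟨ *-identityʳ e ⟩
    e                    ∎

  ScalesDet-⊗ : ∀ n {X Y d e} → ScalesDet n X d → ScalesDet n Y e → ScalesDet n (X ⊗ Y) (d * e)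
  ScalesDet-⊗ n {X} {Y} {d} {e} X-scales Y-scales M = begin
    det n ((X ⊗ Y) ⊗ M)   ≈⟨ det-cong n (⊗-assoc X Y M) ⟩
    det n (X ⊗ (Y ⊗ M))   ≈⟨ X-scales (Y ⊗ M) ⟩
    d * det n (Y ⊗ M)     ≈⟨ *-congˡ (Y-scales M) ⟩
    d * (e * det n M)     ≈⟨ *-assoc d e (det n M) ⟨
    d * e * det n M       ∎

  ScalesDet-idMat : ∀ n → ScalesDet n idMat 1#
  ScalesDet-idMat n M = trans (det-cong n (⊗-identityˡ M)) (sym (*-identityˡ (det n M)))

  elementary-scales : ∀ {n} {p q : Fin (suc n)} (α β : Carrier) (X : Mat (suc n)) → Adjacent p q →
    (∀ x z → x ≢ p → X x z ≈ idMat x z) → (∀ z → X p z ≈ β * idMat p z + α * idMat q z) →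
    ScalesDet (suc n) X β
  elementary-scales {n} {p} {q} α β X adj X-off X-row M = det-rowop α β (X ⊗ M) M adj
    (λ x y x≢p → trans (sumFin-cong (suc n) (λ z → *-congʳ {M z y} (X-off x z x≢p))) (⊗-identityˡ M x y))
    (λ y → begin
      sumFin (suc n) (λ z → X p z * M z y)
        ≈⟨ sumFin-linear (suc n) β α _ _ _ (λ z → trans (*-congʳ {M z y} (X-row z))
             (trans (distribʳ _ _ _) (+-cong (*-assoc _ _ _) (*-assoc _ _ _)))) ⟩
      β * (idMat ⊗ M) p y + α * (idMat ⊗ M) q y
        ≈⟨ +-cong (*-congˡ (⊗-identityˡ M p y)) (*-congˡ (⊗-identityˡ M q y)) ⟩
      β * M p y + α * M q y ∎)

  ScalesDet-prodList : ∀ n (f : ℕ → Mat n) (w : ℕ → Carrier) is →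
    (∀ i → i ∈ is → ScalesDet n (f i) (w i)) → ScalesDet n (prodList (map f is)) (∏ is w)
  ScalesDet-prodList n f w []       scales = ScalesDet-idMat n
  ScalesDet-prodList n f w (i ∷ is) scales =
    ScalesDet-⊗ n (scales i (here ≡.refl)) (ScalesDet-prodList n f w is (λ j j∈is → scales j (there j∈is)))

module ElementaryMatrices {c ℓ} (F : Field c ℓ) where
  open Field F
  open FieldDefs F
  open Matrices F
  open RowOperations F
  open import Relation.Binary.Reasoning.Setoid setoid

  -- A row of the shape of the special rows of U and V: entries C and A in
  -- columns k and k + 1 and zeros elsewhere.
  two-entry-row : ∀ z k (C A D : Carrier) → (z ≢ k → z ≢ suc k → D ≈ 0#) →
    (if ⌊ suc z ℕ.≟ suc k ⌋ then C else if ⌊ suc z ℕ.≟ suc (suc k) ⌋ then A else D)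
      ≈ A * δ (suc k) z + C * δ k z
  two-entry-row z k C A D D≈0 = by-cases (z ℕ.≟ k) (z ℕ.≟ suc k)
    where
    by-cases : Dec (z ≡ k) → Dec (z ≡ suc k) →
      (if ⌊ suc z ℕ.≟ suc k ⌋ then C else if ⌊ suc z ℕ.≟ suc (suc k) ⌋ then A else D)
        ≈ A * δ (suc k) z + C * δ k z
    by-cases (yes ≡.refl) _ rewrite ⌊⌋-yes (suc z ℕ.≟ suc z) ≡.refl = sym (begin
      A * δ (suc z) z + C * δ z z  ≈⟨ +-cong (*-congˡ (δ-offdiag (ℕP.1+n≢n))) (*-congˡ (δ-diag z)) ⟩
      A * 0# + C * 1#              ≈⟨ +-cong (zeroʳ A) (*-identityʳ C) ⟩
      0# + C                       ≈⟨ +-identityˡ C ⟩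
      C                            ∎)
    by-cases (no z≢k) (yes ≡.refl)
      rewrite ⌊⌋-no (suc z ℕ.≟ suc k) (z≢k ∘ ℕP.suc-injective) | ⌊⌋-yes (suc z ℕ.≟ suc z) ≡.refl = sym (begin
      A * δ z z + C * δ k z        ≈⟨ +-cong (*-congˡ (δ-diag z)) (*-congˡ (δ-offdiag (z≢k ∘ ≡.sym))) ⟩
      A * 1# + C * 0#              ≈⟨ +-cong (*-identityʳ A) (zeroʳ C) ⟩
      A + 0#                       ≈⟨ +-identityʳ A ⟩
      A                            ∎)
    by-cases (no z≢k) (no z≢k+1)
      rewrite ⌊⌋-no (suc z ℕ.≟ suc k) (z≢k ∘ ℕP.suc-injective)
            | ⌊⌋-no (suc z ℕ.≟ suc (suc k)) (z≢k+1 ∘ ℕP.suc-injective) = begin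
      D                                ≈⟨ D≈0 z≢k z≢k+1 ⟩
      0#                               ≈⟨ +-identityˡ 0# ⟨
      0# + 0#                          ≈⟨ +-cong (zeroʳ A) (zeroʳ C) ⟨
      A * 0# + C * 0#                  ≈⟨ +-cong (*-congˡ (δ-offdiag (z≢k+1 ∘ ≡.sym))) (*-congˡ (δ-offdiag (z≢k ∘ ≡.sym))) ⟨
      A * δ (suc k) z + C * δ k z      ∎

  U-off : ∀ r i a b c (X Z : Fin (suc r)) → toℕ X ≢ i → U r i a b c X Z ≈ idMat X Z
  U-off r i a b c X Z X≢i rewrite ⌊⌋-no (suc (toℕ X) ℕ.≟ suc i) (X≢i ∘ ℕP.suc-injective) = δ-suc (toℕ X) (toℕ Z)

  U-row : ∀ r (k : Fin r) a b c Z →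
    U r (suc (toℕ k)) a b c (fsuc k) Z ≈ (a ÷ b) * idMat (fsuc k) Z + (c ÷ b) * idMat (inject₁ k) Z
  U-row r k a b c Z rewrite ⌊⌋-yes (suc (suc (toℕ k)) ℕ.≟ suc (suc (toℕ k))) ≡.refl | FinP.toℕ-inject₁ k =
    two-entry-row (toℕ Z) (toℕ k) (c ÷ b) (a ÷ b) _ (λ _ Z≢k+1 → δ-offdiag (Z≢k+1 ∘ ≡.sym ∘ ℕP.suc-injective))

  V-off : ∀ r i a b c (X Z : Fin (suc r)) → suc (toℕ X) ≢ i → V r i a b c X Z ≈ idMat X Z
  V-off r i a b c X Z X≢i rewrite ⌊⌋-no (suc (toℕ X) ℕ.≟ i) X≢i = δ-suc (toℕ X) (toℕ Z)

  V-row : ∀ r (k : Fin r) a b c Z →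
    V r (suc (toℕ k)) a b c (inject₁ k) Z ≈ (b ÷ c) * idMat (inject₁ k) Z + (a ÷ c) * idMat (fsuc k) Z
  V-row r k a b c Z rewrite FinP.toℕ-inject₁ k | ⌊⌋-yes (suc (toℕ k) ℕ.≟ suc (toℕ k)) ≡.refl =
    trans (two-entry-row (toℕ Z) (toℕ k) (b ÷ c) (a ÷ c) _ (λ Z≢k _ → δ-offdiag (Z≢k ∘ ≡.sym ∘ ℕP.suc-injective)))
          (+-comm _ _)

  U-scales : ∀ r (k : Fin r) a b c → ScalesDet (suc r) (U r (suc (toℕ k)) a b c) (a ÷ b)
  U-scales r k a b c = elementary-scales (c ÷ b) (a ÷ b) _ (below k)
    (λ X Z X≢k+1 → U-off r _ a b c X Z (X≢k+1 ∘ FinP.toℕ-injective)) (U-row r k a b c)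

  V-scales : ∀ r (k : Fin r) a b c → ScalesDet (suc r) (V r (suc (toℕ k)) a b c) (b ÷ c)
  V-scales r k a b c = elementary-scales (a ÷ c) (b ÷ c) _ (above k)
    (λ X Z X≢k → V-off r _ a b c X Z (λ e → X≢k (FinP.toℕ-injective (≡.trans (ℕP.suc-injective e) (≡.sym (FinP.toℕ-inject₁ k))))))
    (V-row r k a b c)

module AntiDiagonal {c ℓ} (F : Field c ℓ) where
  open Field F
  open FieldDefs F
  open FieldFacts F
  open Matrices F
  open Products F
  open import Relation.Binary.Reasoning.Setoid setoid
  open import Algebra.Solver.Ring.NaturalCoefficients.Default commutativeSemiring

  antiDiag : ∀ n → (ℕ → Carrier) → Mat (suc n)
  antiDiag n g X Y = if ⌊ toℕ X ℕ.+ toℕ Y ℕ.≟ n ⌋ then g (toℕ X) else 0#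

  toℕ-punchIn-last : ∀ {n} (y : Fin n) → toℕ (punchIn (fromℕ n) y) ≡ toℕ y
  toℕ-punchIn-last fzero    = ≡.refl
  toℕ-punchIn-last (fsuc y) = ≡.cong suc (toℕ-punchIn-last y)

  minor-antiDiag : ∀ n g → minor (antiDiag (suc n) g) (fromℕ (suc n)) ≋ antiDiag n (g ∘ suc)
  minor-antiDiag n g x y rewrite toℕ-punchIn-last y | ⌊suc≟suc⌋ (toℕ x ℕ.+ toℕ y) n = refl

  -- Laplace expansion along the first row, whose only nonzero entry is the last.
  det-antiDiag : ∀ n g → det (suc n) (antiDiag n g) ≈ neg1^ (choose2 (suc n)) * ∏ (upTo (suc n)) g
  det-antiDiag zero    g = begin
    (1# * g 0) * 1# + 0#    ≈⟨ +-identityʳ _ ⟩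
    (1# * g 0) * 1#         ≈⟨ *-assoc 1# (g 0) 1# ⟩
    1# * (g 0 * 1#)         ∎
  det-antiDiag (suc n) g = begin
    det (suc (suc n)) M
      ≈⟨ sumFin-single (suc (suc n)) last term (λ j j≢last →
           trans (*-congʳ (trans (*-congˡ (first-row-off j j≢last)) (zeroʳ _))) (zeroˡ _)) ⟩
    (neg1^ (toℕ last) * M fzero last) * det (suc n) (minor M last)
      ≈⟨ *-cong (*-cong (reflexive (≡.cong neg1^ toℕ-last)) first-row-last)
                (trans (det-cong (suc n) (minor-antiDiag n g)) (det-antiDiag n (g ∘ suc))) ⟩
    (neg1^ (suc n) * g 0) * (neg1^ (choose2 (suc n)) * ∏ (upTo (suc n)) (g ∘ suc))
      ≈⟨ solve 4 (λ s x t p → (s :* x) :* (t :* p) := (s :* t) :* (x :* p)) refl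
           (neg1^ (suc n)) (g 0) (neg1^ (choose2 (suc n))) (∏ (upTo (suc n)) (g ∘ suc)) ⟩
    (neg1^ (suc n) * neg1^ (choose2 (suc n))) * (g 0 * ∏ (upTo (suc n)) (g ∘ suc))
      ≈⟨ *-cong (sym (neg1^-+ (suc n) (choose2 (suc n)))) (reflexive (≡.sym (∏-upTo-suc (suc n) g))) ⟩
    neg1^ (choose2 (suc (suc n))) * ∏ (upTo (suc (suc n))) g ∎
    where
    M : Mat (suc (suc n))
    M = antiDiag (suc n) g
    last : Fin (suc (suc n))
    last = fromℕ (suc n)
    toℕ-last : toℕ last ≡ suc n
    toℕ-last = FinP.toℕ-fromℕ (suc n)
    term : Fin (suc (suc n)) → Carrier
    term j = (neg1^ (toℕ j) * M fzero j) * det (suc n) (minor M j)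
    first-row-off : ∀ j → j ≢ last → M fzero j ≈ 0#
    first-row-off j j≢last
      rewrite ⌊⌋-no (toℕ j ℕ.≟ suc n) (λ e → j≢last (FinP.toℕ-injective (≡.trans e (≡.sym toℕ-last)))) = refl
    first-row-last : M fzero last ≈ g 0
    first-row-last rewrite ⌊⌋-yes (toℕ last ℕ.≟ suc n) toℕ-last = refl

  -- The matrix P is anti-diagonal with entries (-1)^{(r-1)x}; its determinant is
  -- (-1)^{choose2(r+1)} · (-1)^{(r-1)·choose2(r+1)} = (-1)^{r·choose2(r+1)}.
  det-Pmat : ∀ r → 1 ≤ r → det (suc r) (Pmat r) ≈ neg1^ (r ℕ.* choose2 (suc r))
  det-Pmat (suc r') _ = begin
    det (suc r) (antiDiag r (λ x → neg1^ (r' ℕ.* x)))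
      ≈⟨ det-antiDiag r (λ x → neg1^ (r' ℕ.* x)) ⟩
    neg1^ (choose2 (suc r)) * ∏ (upTo (suc r)) (λ x → neg1^ (r' ℕ.* x))
      ≈⟨ *-congˡ (∏-neg1^-linear r' (suc r)) ⟩
    neg1^ (choose2 (suc r)) * neg1^ (r' ℕ.* choose2 (suc r))
      ≈⟨ neg1^-+ (choose2 (suc r)) (r' ℕ.* choose2 (suc r)) ⟨
    neg1^ (r ℕ.* choose2 (suc r)) ∎
    where
    r : ℕ
    r = suc r'

module Glue where
  glue : ∀ {a} {A : Set a} → ℕ → (ℕ → A) → (ℕ → A) → ℕ → A
  glue zero    f g n       = g n
  glue (suc R) f g zero    = f zero
  glue (suc R) f g (suc n) = glue R (f ∘ suc) g n

  glue-below : ∀ {a} {A : Set a} R (f g : ℕ → A) n → n < R → glue R f g n ≡ f n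
  glue-below (suc R) f g zero    _         = ≡.refl
  glue-below (suc R) f g (suc n) (s≤s n<R) = glue-below R (f ∘ suc) g n n<R

  glue-above : ∀ {a} {A : Set a} R (f g : ℕ → A) k → glue R f g (R ℕ.+ k) ≡ g k
  glue-above zero    f g k = ≡.refl
  glue-above (suc R) f g k = glue-above R (f ∘ suc) g k

open Glue

-- d'Alembert's solution of the recurrence  w(i,j+1) w(i,j-1) = - w(i-1,j) w(i+1,j):
-- a product of a function of i + j and a function of j - i, with the sign
-- (-1)^{choose2 j} producing the minus sign.
module Wave {c ℓ} (F : Field c ℓ) where
  open Field F
  open FieldDefs F
  open FieldFacts F
  open import Relation.Binary.Reasoning.Setoid setoid
  open import Algebra.Properties.Ring ring using (-1*x≈-x)
  open import Algebra.Solver.Ring.NaturalCoefficients.Default commutativeSemiring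

  wave : (H L : ℕ → Carrier) (R : ℕ) → ℕ → ℕ → Carrier
  wave H L R i j = neg1^ (choose2 j) * H (i ℕ.+ j) * L ((j ℕ.+ R) ∸ i)

  sign-step : ∀ j → neg1^ (choose2 (suc (suc j))) * neg1^ (choose2 j) ≈ - 1#
  sign-step j = begin
    neg1^ (choose2 (suc (suc j))) * neg1^ (choose2 j)  ≈⟨ neg1^-+ (choose2 (suc (suc j))) (choose2 j) ⟨
    neg1^ (choose2 (suc (suc j)) ℕ.+ choose2 j)        ≡⟨ ≡.cong neg1^ (double j (choose2 j)) ⟩
    - neg1^ ((j ℕ.+ choose2 j) ℕ.* 2)                  ≈⟨ -‿cong (neg1^-even (j ℕ.+ choose2 j)) ⟩
    - 1#                                               ∎
    where
    double : ∀ j c → suc j ℕ.+ (j ℕ.+ c) ℕ.+ c ≡ suc ((j ℕ.+ c) ℕ.* 2)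
    double = solve-∀

  -- For every H, L and R: both sides consist of the same values of H and L.
  wave-recurrence : ∀ H L R i j →
    wave H L R (suc i) (suc (suc j)) * wave H L R (suc i) j
      ≈ - (wave H L R i (suc j) * wave H L R (suc (suc i)) (suc j))
  wave-recurrence H L R i j = begin
    (s₂ * H (suc i ℕ.+ suc (suc j)) * Lb) * (s₀ * H (suc i ℕ.+ j) * Ld)
      ≡⟨ ≡.cong₂ (λ x y → (s₂ * H x * Lb) * (s₀ * H y * Ld))
                 (≡.cong suc (ℕP.+-suc i (suc j))) (≡.sym (ℕP.+-suc i j)) ⟩
    (s₂ * Ha * Lb) * (s₀ * Hc * Ld)
      ≈⟨ solve 6 (λ s t x y u v → (s :* x :* u) :* (t :* y :* v) := (s :* t) :* (x :* y :* u :* v))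
           refl s₂ s₀ Ha Hc Lb Ld ⟩
    (s₂ * s₀) * P
      ≈⟨ *-congʳ (sign-step j) ⟩
    - 1# * P
      ≈⟨ -1*x≈-x P ⟩
    - P
      ≈⟨ -‿cong (trans (*-congʳ (neg1^-square (choose2 (suc j)))) (*-identityˡ P)) ⟨
    - ((s₁ * s₁) * P)
      ≈⟨ -‿cong (solve 5 (λ s x y u v → (s :* s) :* (x :* y :* u :* v) := (s :* y :* u) :* (s :* x :* v))
                   refl s₁ Ha Hc Lb Ld) ⟩
    - ((s₁ * Hc * Lb) * (s₁ * Ha * Ld)) ∎
    where
    s₀ s₁ s₂ Ha Hc Lb Ld P : Carrier
    s₀ = neg1^ (choose2 j)
    s₁ = neg1^ (choose2 (suc j))
    s₂ = neg1^ (choose2 (suc (suc j)))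
    Ha = H (suc (suc i) ℕ.+ suc j)
    Hc = H (i ℕ.+ suc j)
    Lb = L ((suc j ℕ.+ R) ∸ i)
    Ld = L ((j ℕ.+ R) ∸ suc i)
    P = Ha * Hc * Lb * Ld

module Array {c ℓ} (F : Field c ℓ) (r : ℕ) (a : ℕ → Field.Carrier F) where
  open Field F
  open FieldDefs F
  open FieldFacts F
  open import Relation.Binary.Reasoning.Setoid setoid

  A : ℕ → ℕ → Carrier
  A = arr r a

  data Position : ℕ → Set where
    top      : Position 0
    bottom   : Position (suc r)
    interior : ∀ i → i < r → Position (suc i)

  position : ∀ i → i ≤ suc r → Position i
  position zero    _         = top
  position (suc i) (s≤s i≤r) with ℕP.m≤n⇒m<n∨m≡n i≤r
  ... | inj₁ i<r    = interior i i<r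
  ... | inj₂ ≡.refl = bottom

  boundary-bottom : boundary r (suc r) ≡ true
  boundary-bottom rewrite ⌊⌋-no (suc r ℕ.≟ 0) (λ ()) = Equivalence.to T-≡ (ℕP.≤⇒≤ᵇ (ℕP.≤-refl {suc r}))

  boundary-interior : ∀ i → i < r → boundary r (suc i) ≡ false
  boundary-interior i i<r rewrite ⌊⌋-no (suc i ℕ.≟ 0) (λ ()) with suc r ℕ.≤ᵇ suc i in r≤ᵇi
  ... | true  = contradiction (ℕP.≤ᵇ⇒≤ (suc r) (suc i) (Equivalence.from T-≡ r≤ᵇi)) (ℕP.<⇒≱ (s≤s i<r))
  ... | false = ≡.refl

  arr-top : ∀ j → A 0 j ≈ 1#
  arr-top zero          = refl
  arr-top (suc zero)    = refl
  arr-top (suc (suc j)) = refl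

  arr-bottom : ∀ j → A (suc r) j ≈ 1#
  arr-bottom zero          = refl
  arr-bottom (suc zero)    rewrite boundary-bottom = refl
  arr-bottom (suc (suc j)) rewrite boundary-bottom = refl

  arr-first : ∀ i → i < r → A (suc i) 1 ≡ a (suc i)
  arr-first i i<r rewrite boundary-interior i i<r = ≡.refl

  arr-step : ∀ i j → i < r →
             A (suc i) (suc (suc j)) ≡ (- (A i (suc j) * A (suc (suc i)) (suc j))) ÷ A (suc i) j
  arr-step i j i<r rewrite boundary-interior i i<r = ≡.refl

  -- Uniqueness: a function S with the boundary values of the array that
  -- satisfies its recurrence agrees with it, as long as the array is nonzero
  -- (the recurrence divides by it).
  arr-unique : (S : ℕ → ℕ → Carrier) →
    (∀ j → j ≤ suc r → S 0 j ≈ 1#) → (∀ j → j ≤ suc r → S (suc r) j ≈ 1#) →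
    (∀ i → i ≤ suc r → S i 0 ≈ 1#) → (∀ i → i < r → S (suc i) 1 ≈ a (suc i)) →
    (∀ i j → S (suc i) (suc (suc j)) * S (suc i) j ≈ - (S i (suc j) * S (suc (suc i)) (suc j))) →
    (∀ i j → i < r → j < r → ¬ (A (suc i) j ≈ 0#)) →
    ∀ j → j ≤ suc r → ∀ i → i ≤ suc r → A i j ≈ S i j
  arr-unique S S-top S-bottom S-zero S-first S-step A≉0 = depth
    where
    Agree : ℕ → Set ℓ
    Agree j = ∀ i → i ≤ suc r → A i j ≈ S i j

    by-position : ∀ j → j ≤ suc r → (∀ i → i < r → A (suc i) j ≈ S (suc i) j) → Agree j
    by-position j j≤ agree-interior i i≤ with position i i≤
    ... | top          = trans (arr-top j) (sym (S-top j j≤))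
    ... | bottom       = trans (arr-bottom j) (sym (S-bottom j j≤))
    ... | interior i' p = agree-interior i' p

    pairs : ∀ j → j ≤ r → Agree j × Agree (suc j)
    pairs zero    _ = (λ i i≤ → sym (S-zero i i≤))
                    , by-position 1 (s≤s z≤n) (λ i i<r → ≡.subst (_≈ _) (≡.sym (arr-first i i<r)) (sym (S-first i i<r)))
    pairs (suc j) j<r with pairs j (ℕP.<⇒≤ j<r)
    ... | agree₀ , agree₁ = agree₁ , by-position (suc (suc j)) (s≤s j<r) next
      where
      next : ∀ i → i < r → A (suc i) (suc (suc j)) ≈ S (suc i) (suc (suc j))
      next i i<r = sym (≡.subst (S (suc i) (suc (suc j)) ≈_) (≡.sym (arr-step i j i<r))
        (÷-unique (A≉0 i j i<r j<r) (begin
          S (suc i) (suc (suc j)) * A (suc i) j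
            ≈⟨ *-congˡ (agree₀ (suc i) (ℕP.m≤n⇒m≤1+n i<r)) ⟩
          S (suc i) (suc (suc j)) * S (suc i) j
            ≈⟨ S-step i j ⟩
          - (S i (suc j) * S (suc (suc i)) (suc j))
            ≈⟨ -‿cong (*-cong (agree₁ i (ℕP.m≤n⇒m≤1+n (ℕP.<⇒≤ i<r))) (agree₁ (suc (suc i)) (s≤s i<r))) ⟨
          - (A i (suc j) * A (suc (suc i)) (suc j)) ∎)))

    depth : ∀ j → j ≤ suc r → Agree j
    depth zero    _       = proj₁ (pairs 0 z≤n)
    depth (suc j) (s≤s j≤r) = proj₂ (pairs j j≤r)

-- An explicit solution of the recurrence with the boundary values of the array,
-- built from the alternating products  a_{n-1} a_{n-3} ⋯  (assumed nonzero).
module ExplicitSolution {c ℓ} (F : Field c ℓ) (r : ℕ) (a : ℕ → Field.Carrier F)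
                        (a≉0 : ∀ i → i < r → ¬ (Field._≈_ F (a (suc i)) (Field.0# F))) where
  open Field F
  open FieldDefs F
  open FieldFacts F
  open Wave F
  open import Relation.Binary.Reasoning.Setoid setoid
  open import Algebra.Solver.Ring.NaturalCoefficients.Default commutativeSemiring

  R : ℕ
  R = suc r

  stepProd : ℕ → Carrier
  stepProd zero          = 1#
  stepProd (suc zero)    = 1#
  stepProd (suc (suc n)) = a (suc n) * stepProd n

  stepProd-nonzero : ∀ n → n ≤ R → ¬ (stepProd n ≈ 0#)
  stepProd-nonzero zero          _               = 1≉0
  stepProd-nonzero (suc zero)    _               = 1≉0
  stepProd-nonzero (suc (suc n)) (s≤s n+1≤r) =
    *-nonzero (a≉0 n n+1≤r) (stepProd-nonzero n (ℕP.m≤n⇒m≤1+n (ℕP.<⇒≤ n+1≤r)))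

  -- The two factors of the solution, continued beyond R by reflection.
  H-outer L-inner L-outer : ℕ → Carrier
  H-outer k = neg1^ (choose2 k) * stepProd (R ∸ k)
  L-inner t = stepProd (R ∸ t) ⁻¹
  L-outer k = neg1^ (choose2 k) * stepProd k ⁻¹

  H L : ℕ → Carrier
  H = glue R stepProd H-outer
  L = glue R L-inner L-outer

  solution : ℕ → ℕ → Carrier
  solution = wave H L R

  H-low : ∀ n → n ≤ R → H n ≈ stepProd n
  H-low n n≤R with ℕP.m≤n⇒m<n∨m≡n n≤R
  ... | inj₁ n<R    = reflexive (glue-below R stepProd H-outer n n<R)
  ... | inj₂ ≡.refl = begin
    H R            ≡⟨ ≡.cong H (ℕP.+-identityʳ R) ⟨
    H (R ℕ.+ 0)    ≡⟨ glue-above R stepProd H-outer 0 ⟩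
    1# * stepProd R  ≈⟨ *-identityˡ (stepProd R) ⟩
    stepProd R     ∎

  L-low : ∀ t → t ≤ R → L t ≈ stepProd (R ∸ t) ⁻¹
  L-low t t≤R with ℕP.m≤n⇒m<n∨m≡n t≤R
  ... | inj₁ t<R    = reflexive (glue-below R L-inner L-outer t t<R)
  ... | inj₂ ≡.refl = begin
    L R                     ≡⟨ ≡.cong L (ℕP.+-identityʳ R) ⟨
    L (R ℕ.+ 0)             ≡⟨ glue-above R L-inner L-outer 0 ⟩
    1# * stepProd 0 ⁻¹      ≈⟨ *-identityˡ _ ⟩
    stepProd 0 ⁻¹           ≡⟨ ≡.cong (λ n → stepProd n ⁻¹) (ℕP.n∸n≡0 R) ⟨
    stepProd (R ∸ R) ⁻¹     ∎

  L-complement : ∀ i → i ≤ R → L (R ∸ i) ≈ stepProd i ⁻¹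
  L-complement i i≤R = trans (L-low (R ∸ i) (ℕP.m∸n≤m R i)) (reflexive (≡.cong (λ n → stepProd n ⁻¹) (ℕP.m∸[m∸n]≡n i≤R)))

  cancel : ∀ n {x} → ¬ (x ≈ 0#) → (neg1^ n * x) * (neg1^ n * x ⁻¹) ≈ 1#
  cancel n {x} x≉0 = begin
    (neg1^ n * x) * (neg1^ n * x ⁻¹)   ≈⟨ solve 3 (λ s y z → (s :* y) :* (s :* z) := (s :* s) :* (y :* z)) refl (neg1^ n) x (x ⁻¹) ⟩
    (neg1^ n * neg1^ n) * (x * x ⁻¹)   ≈⟨ *-cong (neg1^-square n) (inverse x x≉0) ⟩
    1# * 1#                            ≈⟨ *-identityˡ 1# ⟩
    1#                                 ∎

  solution-top : ∀ j → j ≤ R → solution 0 j ≈ 1#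
  solution-top j j≤R = begin
    neg1^ (choose2 j) * H j * L (j ℕ.+ R)
      ≡⟨ ≡.cong (λ t → neg1^ (choose2 j) * H j * L t) (ℕP.+-comm j R) ⟩
    neg1^ (choose2 j) * H j * L (R ℕ.+ j)
      ≈⟨ *-cong (*-congˡ (H-low j j≤R)) (reflexive (glue-above R L-inner L-outer j)) ⟩
    (neg1^ (choose2 j) * stepProd j) * (neg1^ (choose2 j) * stepProd j ⁻¹)
      ≈⟨ cancel (choose2 j) (stepProd-nonzero j j≤R) ⟩
    1# ∎

  solution-bottom : ∀ j → j ≤ R → solution R j ≈ 1#
  solution-bottom j j≤R = begin
    neg1^ (choose2 j) * H (R ℕ.+ j) * L ((j ℕ.+ R) ∸ R)
      ≈⟨ *-cong (*-congˡ (reflexive (glue-above R stepProd H-outer j)))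
                (trans (reflexive (≡.cong L (ℕP.m+n∸n≡m j R))) (L-low j j≤R)) ⟩
    neg1^ (choose2 j) * (neg1^ (choose2 j) * h) * h ⁻¹
      ≈⟨ solve 3 (λ s y z → s :* (s :* y) :* z := (s :* y) :* (s :* z)) refl (neg1^ (choose2 j)) h (h ⁻¹) ⟩
    (neg1^ (choose2 j) * h) * (neg1^ (choose2 j) * h ⁻¹)
      ≈⟨ cancel (choose2 j) (stepProd-nonzero (R ∸ j) (ℕP.m∸n≤m R j)) ⟩
    1# ∎
    where
    h : Carrier
    h = stepProd (R ∸ j)

  solution-zero : ∀ i → i ≤ R → solution i 0 ≈ 1#
  solution-zero i i≤R = begin
    1# * H (i ℕ.+ 0) * L (R ∸ i)
      ≈⟨ *-cong (*-congˡ (trans (reflexive (≡.cong H (ℕP.+-identityʳ i))) (H-low i i≤R))) (L-complement i i≤R) ⟩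
    1# * stepProd i * stepProd i ⁻¹
      ≈⟨ trans (*-congʳ (*-identityˡ _)) (inverse (stepProd i) (stepProd-nonzero i i≤R)) ⟩
    1# ∎

  solution-first : ∀ i → i < r → solution (suc i) 1 ≈ a (suc i)
  solution-first i i<r = begin
    1# * H (suc i ℕ.+ 1) * L (R ∸ i)
      ≈⟨ *-cong (*-congˡ (trans (reflexive (≡.cong (H ∘ suc) (ℕP.+-comm i 1))) (H-low (suc (suc i)) (s≤s i<r))))
                (L-complement i i≤R) ⟩
    1# * (a (suc i) * stepProd i) * stepProd i ⁻¹
      ≈⟨ trans (*-congʳ (*-identityˡ _)) (*-assoc _ _ _) ⟩
    a (suc i) * (stepProd i * stepProd i ⁻¹)
      ≈⟨ trans (*-congˡ (inverse (stepProd i) (stepProd-nonzero i i≤R))) (*-identityʳ _) ⟩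
    a (suc i) ∎
    where i≤R = ℕP.m≤n⇒m≤1+n (ℕP.<⇒≤ i<r)

  solution-last : ∀ i → i ≤ r → solution (suc i) R ≈ neg1^ (r ℕ.* suc i)
  solution-last i i≤r = begin
    neg1^ (choose2 R) * H (suc i ℕ.+ R) * L ((R ℕ.+ R) ∸ suc i)
      ≡⟨ ≡.cong₂ (λ x y → neg1^ (choose2 R) * H x * L y) (ℕP.+-comm (suc i) R) (ℕP.+-∸-assoc R (s≤s i≤r)) ⟩
    neg1^ (choose2 R) * H (R ℕ.+ suc i) * L (R ℕ.+ k)
      ≈⟨ *-cong (*-congˡ (reflexive (glue-above R stepProd H-outer (suc i)))) (reflexive (glue-above R L-inner L-outer k)) ⟩
    neg1^ (choose2 R) * (neg1^ (choose2 (suc i)) * stepProd k) * (neg1^ (choose2 k) * stepProd k ⁻¹)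
      ≈⟨ solve 5 (λ s t u x y → s :* (t :* x) :* (u :* y) := (s :* t :* u) :* (x :* y)) refl
           (neg1^ (choose2 R)) (neg1^ (choose2 (suc i))) (neg1^ (choose2 k)) (stepProd k) (stepProd k ⁻¹) ⟩
    (neg1^ (choose2 R) * neg1^ (choose2 (suc i)) * neg1^ (choose2 k)) * (stepProd k * stepProd k ⁻¹)
      ≈⟨ trans (*-congˡ (inverse (stepProd k) (stepProd-nonzero k (ℕP.m∸n≤m R (suc i))))) (*-identityʳ _) ⟩
    neg1^ (choose2 R) * neg1^ (choose2 (suc i)) * neg1^ (choose2 k)
      ≈⟨ trans (neg1^-+ (choose2 R ℕ.+ choose2 (suc i)) (choose2 k)) (*-congʳ (neg1^-+ (choose2 R) (choose2 (suc i)))) ⟨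
    neg1^ (choose2 R ℕ.+ choose2 (suc i) ℕ.+ choose2 k)
      ≡⟨ ≡.cong (λ n → neg1^ (choose2 n ℕ.+ choose2 (suc i) ℕ.+ choose2 k)) (≡.cong suc i+k≡r) ⟨
    neg1^ (choose2 (suc i ℕ.+ k) ℕ.+ choose2 (suc i) ℕ.+ choose2 k)
      ≡⟨ ≡.cong neg1^ (choose2-corner i k) ⟩
    neg1^ ((i ℕ.+ k) ℕ.* suc i ℕ.+ choose2 k ℕ.* 2)
      ≈⟨ neg1^-+even ((i ℕ.+ k) ℕ.* suc i) (choose2 k) ⟩
    neg1^ ((i ℕ.+ k) ℕ.* suc i)
      ≡⟨ ≡.cong (λ n → neg1^ (n ℕ.* suc i)) i+k≡r ⟩
    neg1^ (r ℕ.* suc i) ∎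
    where
    k : ℕ
    k = R ∸ suc i
    i+k≡r : i ℕ.+ k ≡ r
    i+k≡r = ℕP.m+[n∸m]≡n i≤r

module ProductDeterminant {c ℓ} (F : Field c ℓ) (r : ℕ) (a : ℕ → Field.Carrier F) where
  open Field F
  open FieldDefs F
  open Products F
  open RowOperations F
  open ElementaryMatrices F
  open Array F r a
  open import Relation.Binary.Reasoning.Setoid setoid

  ratio : ℕ → ℕ → Carrier
  ratio i m = A i (suc m) ÷ A i m

  -- N_{i+1,-m} is U or V according to parity; either way it scales by ratio (i+1) m.
  N-scales : ∀ i → i < r → ∀ m → ScalesDet (suc r) (N r a (suc i) m) (ratio (suc i) m)
  N-scales i i<r m with odd (suc i ℕ.+ m)
  ... | true  = ≡.subst (λ t → ScalesDet (suc r) (U r (suc t) (A (suc i) (suc m)) (A (suc i) m) (A (suc (suc i)) (suc m)))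
                                         (ratio (suc i) m))
                        (FinP.toℕ-fromℕ< i<r) (U-scales r (Fin.fromℕ< i<r) _ _ _)
  ... | false = ≡.subst (λ t → ScalesDet (suc r) (V r (suc t) (A i m) (A (suc i) (suc m)) (A (suc i) m))
                                         (ratio (suc i) m))
                        (FinP.toℕ-fromℕ< i<r) (V-scales r (Fin.fromℕ< i<r) _ _ _)

  -- Each layer (fixed depth m) scales by a product over the rows; exchanging
  -- the two products, each row telescopes over the depths.
  det-Prod-telescopes : (∀ i m → i < r → m ≤ r → ¬ (A (suc i) m ≈ 0#)) →
                        det (suc r) (Prod r a) ≈ ∏ (upTo r) (λ i → A (suc i) (suc r))
  det-Prod-telescopes A≉0 = begin
    det (suc r) (Prod r a)
      ≈⟨ ScalesDet-det (suc r) {Prod r a}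
           (ScalesDet-prodList (suc r) layer _ (downFrom (suc r)) (λ m _ → layer-scales m)) ⟩
    ∏ (downFrom (suc r)) (λ m → ∏ (upTo r) (λ i → ratio (suc i) m))
      ≈⟨ ∏-comm (downFrom (suc r)) (upTo r) (λ m i → ratio (suc i) m) ⟩
    ∏ (upTo r) (λ i → ∏ (downFrom (suc r)) (ratio (suc i)))
      ≈⟨ ∏-cong (upTo r) (λ i i∈ → telescope i (∈-upTo⁻ i∈)) ⟩
    ∏ (upTo r) (λ i → A (suc i) (suc r)) ∎
    where
    layer : ℕ → Mat (suc r)
    layer m = prodList (map (λ i → N r a (suc i) m) (upTo r))
    layer-scales : ∀ m → ScalesDet (suc r) (layer m) (∏ (upTo r) (λ i → ratio (suc i) m))
    layer-scales m = ScalesDet-prodList (suc r) (λ i → N r a (suc i) m) _ (upTo r)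
                       (λ i i∈ → N-scales i (∈-upTo⁻ i∈) m)
    telescope : ∀ i → i < r → ∏ (downFrom (suc r)) (ratio (suc i)) ≈ A (suc i) (suc r)
    telescope i i<r = trans (sym (*-identityʳ _))
      (∏-telescope (A (suc i)) (suc r) (λ m m≤r → A≉0 i m i<r (ℕP.≤-pred m≤r)))

  array-last-column : (∀ i j → i ≤ suc r → j ≤ suc r → ¬ (A i j ≈ 0#)) →
                      ∀ i → i < r → A (suc i) (suc r) ≈ neg1^ (r ℕ.* suc i)
  array-last-column A≉0 i i<r = begin
    A (suc i) (suc r)          ≈⟨ agree (suc r) ℕP.≤-refl (suc i) (s≤s (ℕP.<⇒≤ i<r)) ⟩
    solution (suc i) (suc r)   ≈⟨ solution-last i (ℕP.<⇒≤ i<r) ⟩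
    neg1^ (r ℕ.* suc i)        ∎
    where
    a≉0 : ∀ i → i < r → ¬ (a (suc i) ≈ 0#)
    a≉0 i i<r a≈0 = A≉0 (suc i) 1 (s≤s (ℕP.<⇒≤ i<r)) (s≤s z≤n) (trans (reflexive (arr-first i i<r)) a≈0)
    open ExplicitSolution F r a a≉0
    agree : ∀ j → j ≤ suc r → ∀ i → i ≤ suc r → A i j ≈ solution i j
    agree = arr-unique solution solution-top solution-bottom solution-zero solution-first
              (Wave.wave-recurrence F H L R)
              (λ i j i<r j<r → A≉0 (suc i) j (s≤s (ℕP.<⇒≤ i<r)) (ℕP.m≤n⇒m≤1+n (ℕP.<⇒≤ j<r)))

  det-Prod : (∀ i j → i ≤ suc r → j ≤ suc r → ¬ (A i j ≈ 0#)) →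
             det (suc r) (Prod r a) ≈ neg1^ (r ℕ.* choose2 (suc r))
  det-Prod A≉0 = begin
    det (suc r) (Prod r a)
      ≈⟨ det-Prod-telescopes (λ i m i<r m≤r → A≉0 (suc i) m (s≤s (ℕP.<⇒≤ i<r)) (ℕP.m≤n⇒m≤1+n m≤r)) ⟩
    ∏ (upTo r) (λ i → A (suc i) (suc r))
      ≈⟨ ∏-cong (upTo r) (λ i i∈ → array-last-column A≉0 i (∈-upTo⁻ i∈)) ⟩
    ∏ (upTo r) (λ i → neg1^ (r ℕ.* suc i))
      ≈⟨ *-identityˡ _ ⟨
    1# * ∏ (upTo r) (λ i → neg1^ (r ℕ.* suc i))
      ≈⟨ *-congʳ (reflexive (≡.cong neg1^ (ℕP.*-zeroʳ r))) ⟨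
    neg1^ (r ℕ.* 0) * ∏ (upTo r) (λ i → neg1^ (r ℕ.* suc i))
      ≡⟨ ∏-upTo-suc r (λ x → neg1^ (r ℕ.* x)) ⟨
    ∏ (upTo (suc r)) (λ x → neg1^ (r ℕ.* x))
      ≈⟨ ∏-neg1^-linear r (suc r) ⟩
    neg1^ (r ℕ.* choose2 (suc r)) ∎

neg1^-signExp : ∀ {c ℓ} (F : Field c ℓ) r →
  Field._≈_ F (FieldDefs.neg1^ F (FieldDefs.signExp F r)) (FieldDefs.neg1^ F (r ℕ.* choose2 (suc r)))
neg1^-signExp F r = Field.trans F (Field.reflexive F (≡.cong neg1^ (signExp-choose2 r)))
                                  (neg1^-+even (r ℕ.* choose2 (suc r)) (choose2 (suc r)))
  where
  open FieldDefs F
  open FieldFacts F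

lemma5p15 : ∀ {c ℓ} (F : Field c ℓ) (r : ℕ) → 1 ≤ r → (a : ℕ → Field.Carrier F)
    → (∀ i j → i ≤ suc r → j ≤ suc r → ¬ (Field._≈_ F (FieldDefs.arr F r a i j) (Field.0# F)))
    → Field._≈_ F (FieldDefs.det F (suc r) (FieldDefs.Prod F r a)) (FieldDefs.det F (suc r) (FieldDefs.Pmat F r))
    × Field._≈_ F (FieldDefs.det F (suc r) (FieldDefs.Pmat F r)) (FieldDefs.neg1^ F (FieldDefs.signExp F r))
lemma5p15 F r 1≤r a A≉0 =
    trans (ProductDeterminant.det-Prod F r a A≉0) (sym det-P)
  , trans det-P (sym (neg1^-signExp F r))
  where
  open Field F using (trans; sym)
  det-P : Field._≈_ F (FieldDefs.det F (suc r) (FieldDefs.Pmat F r)) (FieldDefs.neg1^ F (r ℕ.* choose2 (suc r)))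
  det-P = AntiDiagonal.det-Pmat F r 1≤r
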